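{- Let $n\ge 2$ targets $\mathcal T=\{1,\dots,n\}$ be given with travel times $c(u,v)>0$ ($u\ne v$) satisfying the triangle inequality. For every integer $k>n^2-n$ that is not an integral multiple of $n$, $\mathcal R^*(k)\le\mathcal R^*(n+1)$.
   Context: Targets $\mathcal T=\{1,\dots,n\}$, $n\ge 2$; travel times $c(u,v)>0$ for distinct $u,v\in\mathcal T$ (set $c(u,u)=0$), satisfying $c(u,v)+c(v,w)\ge c(u,w)$ for all $u,v,w\in\mathcal T$. For an integer $k\ge n$, a closed walk with $k$ visits is a sequence $\mathcal W=(v_1,\dots,v_{k+1})$ of targets with $v_{k+1}=v_1$, $v_i\ne v_{i+1}$ for $1\le i\le k$, and every target appearing among $v_1,\dots,v_k$. The walk is repeated forever: extend it to the infinite periodic sequence $(v_i)_{i\ge 1}$ with $v_{i+k}=v_i$, where moving from $v_i$ to $v_{i+1}$ takes time $c(v_i,v_{i+1})$. For a target $d$, the revisit time $RT(d,\mathcal W)$ is the maximum, over all pairs of indices $i<j$ with $v_i=v_j=d$ and $v_l\ne d$ for $i<l<j$, of $\sum_{l=i}^{j-1}c(v_l,v_{l+1})$. The revisit time of the walk is $\mathcal R(\mathcal W)=\max_{d\in\mathcal T}RT(d,\mathcal W)$, and $\mathcal R^*(k)$ is the minimum of $\mathcal R(\mathcal W)$ over all closed walks with $k$ visits (with the convention $\mathcal R^*(k)=+\infty$ if no such walk exists).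
   Formalization: The travel times $c(u,v)$ take values in the rationals. -}

module Defs where

open import Data.Nat using (ℕ; zero; suc; _+_; _≤_; _<_)
open import Data.Fin using (Fin)
open import Data.Product using (∃; _×_)
open import Relation.Binary.PropositionalEquality using (_≡_; _≢_)
open import Data.Rational using (ℚ; 0ℚ) renaming (_+_ to _+ℚ_; _≤_ to _≤ℚ_; _<_ to _<ℚ_)

TravelTimes : ℕ → Set
TravelTimes n = Fin n → Fin n → ℚ

ValidTravelTimes : (n : ℕ) → TravelTimes n → Set
ValidTravelTimes n c =
  (∀ u v → u ≢ v → 0ℚ <ℚ c u v) ×
  (∀ u → c u u ≡ 0ℚ) ×
  (∀ u v w → c u w ≤ℚ (c u v +ℚ c v w))

-- A closed walk with k visits, already unfolded into its infinite periodic
-- sequence (0-indexed): seq i = v_{i+1}, seq (i + k) = seq i.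
record ClosedWalk (n k : ℕ) : Set where
  field
    seq      : ℕ → Fin n
    periodic : ∀ i → seq (i + k) ≡ seq i
    noStay   : ∀ i → seq i ≢ seq (suc i)
    covers   : ∀ (d : Fin n) → ∃ λ i → i < k × seq i ≡ d
open ClosedWalk public

pathCost : {n : ℕ} → TravelTimes n → (ℕ → Fin n) → ℕ → ℕ → ℚ
pathCost c s i zero    = 0ℚ
pathCost c s i (suc m) = c (s i) (s (suc i)) +ℚ pathCost c s (suc i) m

-- "R(W) ≤ r": every revisit time (from an occurrence at index i to the next
-- occurrence of the same target at index i + suc m) is at most r.
RevisitBoundedBy : {n k : ℕ} → TravelTimes n → ClosedWalk n k → ℚ → Set
RevisitBoundedBy c W r =
  ∀ (i m : ℕ) →
  seq W (i + suc m) ≡ seq W i →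
  (∀ l → 1 ≤ l → l ≤ m → seq W (i + l) ≢ seq W i) →
  pathCost c (seq W) i (suc m) ≤ℚ r

module Submission where

-- A closed walk with n + 1 visits of n targets visits one target twice and every other target once;
-- rotate it so that the repeated target sits at visits 0 and J. Deleting visit J from a period still
-- leaves a closed walk, since visits J − 1 and J + 1 carry different targets. As n² − n − 1 is the
-- Frobenius number of n and n + 1, k = x n + y (n + 1), and the new walk runs through x shortened
-- periods followed by y full ones. Between two consecutive visits of a target it shortcuts, by the
-- triangle inequality, at most n + 1 moves of the old walk; these cost at most one full period, which
-- is the revisit time of any target the old walk visits only once.

open import Defs
open import Data.Nat using (ℕ; zero; suc; _+_; _*_; _∸_; _≤_; _<_; z≤n; s≤s; NonZero; _%_; _/_)
import Data.Nat.Properties as ℕ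
open import Data.Nat.DivMod
open import Data.Nat.Divisibility using (_∣_; n∣m*n)
open import Data.Nat.Tactic.RingSolver using (solve-∀)
open import Data.Fin using (Fin; toℕ; fromℕ<; punchOut)
import Data.Fin.Properties as Fin
open import Data.Product using (∃; ∃₂; _×_; _,_; proj₁; proj₂)
open import Data.Sum using (_⊎_; inj₁; inj₂)
open import Data.Rational using (ℚ; 0ℚ) renaming (_+_ to _+ℚ_; _≤_ to _≤ℚ_)
import Data.Rational.Properties as ℚ
open import Algebra.Properties.Group ℚ.+-0-group using (∙-cancelˡ)
open import Function using (_∘_; _∘′_)
open import Function.Bundles using (_⇔_; mk⇔; Equivalence)
open import Function.Definitions using (Injective)
open import Relation.Binary.Definitions using (DecidableEquality)
open import Relation.Binary.PropositionalEquality hiding (J)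
open import Relation.Nullary using (¬_; Dec; yes; no; contradiction)
open import Relation.Nullary.Decidable using (_×-dec_)
open import Relation.Unary using (Pred; Decidable)

∸-telescope : ∀ {a b d} → a ≤ b → b ≤ d → (b ∸ a) + (d ∸ b) ≡ d ∸ a
∸-telescope {a} {b} {d} a≤b b≤d = begin
  (b ∸ a) + (d ∸ b)   ≡⟨ ℕ.+-comm (b ∸ a) (d ∸ b) ⟩
  (d ∸ b) + (b ∸ a)   ≡⟨ ℕ.+-∸-assoc (d ∸ b) a≤b ⟨
  (d ∸ b) + b ∸ a     ≡⟨ cong (_∸ a) (ℕ.m∸n+n≡m b≤d) ⟩
  d ∸ a               ∎
  where open ≡-Reasoning

module PathCost {n : ℕ} (c : TravelTimes n) where

  pathCost-+ : ∀ s a m m′ → pathCost c s a (m + m′) ≡ pathCost c s a m +ℚ pathCost c s (a + m) m′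
  pathCost-+ s a zero    m′ rewrite ℕ.+-identityʳ a = sym (ℚ.+-identityˡ _)
  pathCost-+ s a (suc m) m′ rewrite pathCost-+ s (suc a) m m′ | ℕ.+-suc a m =
    sym (ℚ.+-assoc (c (s a) (s (suc a))) _ _)

  pathCost-shift : ∀ s i a m → pathCost c (λ l → s (i + l)) a m ≡ pathCost c s (i + a) m
  pathCost-shift s i a zero    = refl
  pathCost-shift s i a (suc m) rewrite pathCost-shift s i (suc a) m | ℕ.+-suc i a = refl

  pathCost-rotate : ∀ s P → (∀ l → s (l + P) ≡ s l) → ∀ a → pathCost c s a P ≡ pathCost c s 0 P
  pathCost-rotate s P periodic zero    = refl
  pathCost-rotate s P periodic (suc a) = trans (∙-cancelˡ step _ _ shifted) (pathCost-rotate s P periodic a)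
    where
      open ≡-Reasoning
      step = c (s a) (s (suc a))
      shifted : step +ℚ pathCost c s (suc a) P ≡ step +ℚ pathCost c s a P
      shifted = begin
        step +ℚ pathCost c s (suc a) P                      ≡⟨⟩
        pathCost c s a (suc P)                              ≡⟨ cong (pathCost c s a) (ℕ.+-comm 1 P) ⟩
        pathCost c s a (P + 1)                              ≡⟨ pathCost-+ s a P 1 ⟩
        pathCost c s a P +ℚ (c (s (a + P)) (s (suc (a + P))) +ℚ 0ℚ)
          ≡⟨ cong (pathCost c s a P +ℚ_) (ℚ.+-identityʳ _) ⟩
        pathCost c s a P +ℚ c (s (a + P)) (s (suc a + P))   ≡⟨ cong₂ (λ u v → pathCost c s a P +ℚ c u v) (periodic a) (periodic (suc a)) ⟩
        pathCost c s a P +ℚ step                            ≡⟨ ℚ.+-comm _ step ⟩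
        step +ℚ pathCost c s a P                            ∎

  module _ (valid : ValidTravelTimes n c) where
    private
      c-pos  = proj₁ valid
      c-diag = proj₁ (proj₂ valid)
      c-tri  = proj₂ (proj₂ valid)

    travelTime-nonNeg : ∀ u v → 0ℚ ≤ℚ c u v
    travelTime-nonNeg u v with u Fin.≟ v
    ... | yes refl = ℚ.≤-reflexive (sym (c-diag u))
    ... | no u≢v   = ℚ.<⇒≤ (c-pos u v u≢v)

    pathCost-nonNeg : ∀ s a m → 0ℚ ≤ℚ pathCost c s a m
    pathCost-nonNeg s a zero    = ℚ.≤-refl
    pathCost-nonNeg s a (suc m) = ℚ.+-mono-≤ (travelTime-nonNeg (s a) (s (suc a))) (pathCost-nonNeg s (suc a) m)

    pathCost-mono : ∀ s a {m m′} → m ≤ m′ → pathCost c s a m ≤ℚ pathCost c s a m′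
    pathCost-mono s a {m} {m′} m≤m′ = begin
      pathCost c s a m                                        ≡⟨ ℚ.+-identityʳ _ ⟨
      pathCost c s a m +ℚ 0ℚ                                  ≤⟨ ℚ.+-monoʳ-≤ (pathCost c s a m) (pathCost-nonNeg s (a + m) (m′ ∸ m)) ⟩
      pathCost c s a m +ℚ pathCost c s (a + m) (m′ ∸ m)       ≡⟨ pathCost-+ s a m (m′ ∸ m) ⟨
      pathCost c s a (m + (m′ ∸ m))                           ≡⟨ cong (pathCost c s a) (ℕ.m+[n∸m]≡n m≤m′) ⟩
      pathCost c s a m′                                       ∎
      where open ℚ.≤-Reasoning

    travelTime≤pathCost : ∀ s a m → c (s a) (s (a + m)) ≤ℚ pathCost c s a m
    travelTime≤pathCost s a zero rewrite ℕ.+-identityʳ a | c-diag (s a) = ℚ.≤-refl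
    travelTime≤pathCost s a (suc m) = begin
      c (s a) (s (a + suc m))                                  ≤⟨ c-tri (s a) (s (suc a)) (s (a + suc m)) ⟩
      c (s a) (s (suc a)) +ℚ c (s (suc a)) (s (a + suc m))     ≡⟨ cong (λ p → c (s a) (s (suc a)) +ℚ c (s (suc a)) (s p)) (ℕ.+-suc a m) ⟩
      c (s a) (s (suc a)) +ℚ c (s (suc a)) (s (suc a + m))     ≤⟨ ℚ.+-monoʳ-≤ (c (s a) (s (suc a))) (travelTime≤pathCost s (suc a) m) ⟩
      pathCost c s a (suc m)                                   ∎
      where open ℚ.≤-Reasoning

    pathCost-shortcut : ∀ s (g : ℕ → ℕ) → (∀ l → g l ≤ g (suc l)) →
                        ∀ M l → pathCost c (s ∘ g) l M ≤ℚ pathCost c s (g l) (g (l + M) ∸ g l)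
    pathCost-shortcut s g g-mono zero    l = pathCost-nonNeg s (g l) (g (l + zero) ∸ g l)
    pathCost-shortcut s g g-mono (suc M) l = begin
      c (s (g l)) (s (g (suc l))) +ℚ pathCost c (s ∘ g) (suc l) M
        ≤⟨ ℚ.+-mono-≤ first (pathCost-shortcut s g g-mono M (suc l)) ⟩
      pathCost c s (g l) δ +ℚ pathCost c s (g (suc l)) (g (suc l + M) ∸ g (suc l))
        ≡⟨ cong (λ p → pathCost c s (g l) δ +ℚ pathCost c s p (g (suc l + M) ∸ g (suc l))) (ℕ.m+[n∸m]≡n (g-mono l)) ⟨
      pathCost c s (g l) δ +ℚ pathCost c s (g l + δ) (g (suc l + M) ∸ g (suc l))
        ≡⟨ pathCost-+ s (g l) δ _ ⟨
      pathCost c s (g l) (δ + (g (suc l + M) ∸ g (suc l)))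
        ≡⟨ cong (pathCost c s (g l)) (∸-telescope (g-mono l) (g-mono-range (suc l) M)) ⟩
      pathCost c s (g l) (g (suc l + M) ∸ g l)
        ≡⟨ cong (λ p → pathCost c s (g l) (g p ∸ g l)) (ℕ.+-suc l M) ⟨
      pathCost c s (g l) (g (l + suc M) ∸ g l)
        ∎
      where
        open ℚ.≤-Reasoning
        δ = g (suc l) ∸ g l
        first : c (s (g l)) (s (g (suc l))) ≤ℚ pathCost c s (g l) δ
        first = subst (λ p → c (s (g l)) (s p) ≤ℚ pathCost c s (g l) δ)
                      (ℕ.m+[n∸m]≡n (g-mono l)) (travelTime≤pathCost s (g l) δ)
        g-mono-range : ∀ l M → g l ≤ g (l + M)
        g-mono-range l zero    rewrite ℕ.+-identityʳ l = ℕ.≤-refl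
        g-mono-range l (suc M) rewrite ℕ.+-suc l M = ℕ.≤-trans (g-mono-range l M) (g-mono (l + M))

injection-misses-at-most-one : ∀ {m} (h : Fin (suc m) → Fin (suc (suc m))) → Injective _≡_ _≡_ h →
                               ∀ {e₁ e₂} → (∀ y → h y ≢ e₁) → (∀ y → h y ≢ e₂) → e₁ ≡ e₂
injection-misses-at-most-one {m} h h-inj {e₁} {e₂} h≢e₁ h≢e₂ with e₁ Fin.≟ e₂
... | yes e₁≡e₂ = e₁≡e₂
... | no  e₁≢e₂ = contradiction (Fin.injective⇒≤ h″-inj) (ℕ.n≮n m)
  where
    e₁≢h : ∀ y → e₁ ≢ h y
    e₁≢h y = h≢e₁ y ∘ sym
    h′ : Fin (suc m) → Fin (suc m)
    h′ y = punchOut (e₁≢h y)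
    e₂′≢h′ : ∀ y → punchOut e₁≢e₂ ≢ h′ y
    e₂′≢h′ y = h≢e₂ y ∘ sym ∘ Fin.punchOut-injective e₁≢e₂ (e₁≢h y)
    h″ : Fin (suc m) → Fin m
    h″ y = punchOut (e₂′≢h′ y)
    h″-inj : Injective _≡_ _≡_ h″
    h″-inj {y} {z} = h-inj ∘ Fin.punchOut-injective (e₁≢h y) (e₁≢h z)
                           ∘ Fin.punchOut-injective (e₂′≢h′ y) (e₂′≢h′ z)

section-misses-collision : ∀ {A B : Set} → DecidableEquality A → (f : A → B) (h : B → A) → (∀ y → f (h y) ≡ y) →
                           ∀ {a b} → a ≢ b → f a ≡ f b → ∃ λ e → f e ≡ f a × (∀ y → h y ≢ e)
section-misses-collision _≟_ f h f∘h≗id {a} {b} a≢b fa≡fb = pick (h (f a) ≟ a)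
  where
    fixed : ∀ {e} y → h y ≡ e → h (f e) ≡ e
    fixed y refl = cong h (f∘h≗id y)
    pick : Dec (h (f a) ≡ a) → ∃ λ e → f e ≡ f a × (∀ y → h y ≢ e)
    pick (yes hfa≡a) = b , sym fa≡fb , λ y hy≡b → a≢b (trans (sym hfa≡a) (trans (cong h fa≡fb) (fixed y hy≡b)))
    pick (no  hfa≢a) = a , refl , λ y hy≡a → hfa≢a (fixed y hy≡a)

surjection-collisions-agree : ∀ {m} (f : Fin (suc (suc m)) → Fin (suc m)) → (∀ y → ∃ λ x → f x ≡ y) →
                              ∀ {a b t u} → a ≢ b → f a ≡ f b → t ≢ u → f t ≡ f u → f t ≡ f a
surjection-collisions-agree f surjective a≢b fa≡fb t≢u ft≡fu =
  let e  , fe≡fa  , h≢e  = section-misses-collision Fin._≟_ f h f∘h≗id a≢b fa≡fb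
      e′ , fe′≡ft , h≢e′ = section-misses-collision Fin._≟_ f h f∘h≗id t≢u ft≡fu
  in trans (sym fe′≡ft) (trans (cong f (sym (injection-misses-at-most-one h h-inj h≢e h≢e′))) fe≡fa)
  where
    h = proj₁ ∘ surjective
    f∘h≗id = proj₂ ∘ surjective
    h-inj : Injective _≡_ _≡_ h
    h-inj {y} {z} hy≡hz = trans (sym (f∘h≗id y)) (trans (cong f hy≡hz) (f∘h≗id z))

-- visit enumerates ℕ ∖ S when 0 ∉ S and S contains no two consecutive numbers.
module Skipping {ℓ} {S : Pred ℕ ℓ} (S? : Decidable S) where

  next : ℕ → ℕ
  next p with S? (suc p)
  ... | yes _ = suc (suc p)
  ... | no  _ = suc p

  visit : ℕ → ℕ
  visit zero    = 0
  visit (suc l) = next (visit l)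

  next-cases : ∀ p → (next p ≡ suc p × ¬ S (suc p)) ⊎ (next p ≡ suc (suc p) × S (suc p))
  next-cases p with S? (suc p)
  ... | yes s = inj₂ (refl , s)
  ... | no ¬s = inj₁ (refl , ¬s)

  next-∉ : ∀ {p} → ¬ S (suc p) → next p ≡ suc p
  next-∉ {p} ¬s with S? (suc p)
  ... | yes s = contradiction s ¬s
  ... | no  _ = refl

  next-∈ : ∀ {p} → S (suc p) → next p ≡ suc (suc p)
  next-∈ {p} s with S? (suc p)
  ... | yes _  = refl
  ... | no  ¬s = contradiction s ¬s

  visit-< : ∀ l → visit l < visit (suc l)
  visit-< l with next-cases (visit l)
  ... | inj₁ (eq , _) rewrite eq = ℕ.n<1+n (visit l)
  ... | inj₂ (eq , _) rewrite eq = ℕ.m<n⇒m<1+n (ℕ.n<1+n (visit l))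

  between-visits-∈ : ∀ l {p} → visit l < p → p < visit (suc l) → S p
  between-visits-∈ l {p} l< <l with next-cases (visit l)
  ... | inj₁ (eq , _) rewrite eq = contradiction l< (ℕ.<⇒≱ <l)
  ... | inj₂ (eq , s) rewrite eq with ℕ.m≤n⇒m<n∨m≡n l<
  ...   | inj₁ 1+l<p = contradiction 1+l<p (ℕ.<⇒≱ <l)
  ...   | inj₂ refl  = s

  visit-hits : ∀ M l {p} → visit l ≤ p → p ≤ visit (l + M) → ¬ S p → ∃ λ t → t ≤ M × visit (l + t) ≡ p
  visit-hits zero l {p} l≤ ≤l+M _ rewrite ℕ.+-identityʳ l =
    0 , z≤n , trans (cong visit (ℕ.+-identityʳ l)) (ℕ.≤-antisym l≤ ≤l+M)
  visit-hits (suc M) l {p} l≤ ≤l+M ¬s with ℕ.m≤n⇒m<n∨m≡n l≤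
  ... | inj₂ l≡p = 0 , z≤n , trans (cong visit (ℕ.+-identityʳ l)) l≡p
  ... | inj₁ l<p with p ℕ.<? visit (suc l)
  ...   | yes p<l+1 = contradiction (between-visits-∈ l l<p p<l+1) ¬s
  ...   | no  p≮l+1 with visit-hits M (suc l) (ℕ.≮⇒≥ p≮l+1) (subst (λ i → p ≤ visit i) (ℕ.+-suc l M) ≤l+M) ¬s
  ...     | t , t≤M , eq = suc t , s≤s t≤M , trans (cong visit (ℕ.+-suc l t)) eq

  visit-run : ∀ T L {p} → visit L ≡ p → (∀ o → o < T → ¬ S (suc (p + o))) → visit (L + T) ≡ p + T
  visit-run zero    L {p} eq _ rewrite ℕ.+-identityʳ L | ℕ.+-identityʳ p = eq
  visit-run (suc T) L {p} eq ∉ rewrite ℕ.+-suc L T | ℕ.+-suc p T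
                                     | visit-run T L eq (λ o o<T → ∉ o (ℕ.m<n⇒m<1+n o<T)) =
    next-∉ (∉ T (ℕ.n<1+n T))

  visit-periodic : ∀ {k Q} → (∀ p → S (p + Q) ⇔ S p) → visit k ≡ Q → ∀ l → visit (l + k) ≡ visit l + Q
  visit-periodic {k} {Q} S-periodic visit-k zero = visit-k
  visit-periodic {k} {Q} S-periodic visit-k (suc l) =
    trans (cong next (visit-periodic S-periodic visit-k l)) (next-+ (visit l))
    where
      next-+ : ∀ p → next (p + Q) ≡ next p + Q
      next-+ p with next-cases p
      ... | inj₁ (eq , ¬s) rewrite eq = next-∉ (λ s → ¬s (Equivalence.to (S-periodic (suc p)) s))
      ... | inj₂ (eq , s)  rewrite eq = next-∈ (Equivalence.from (S-periodic (suc p)) s)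

  visit-first-return : ∀ {a} {A : Set a} (u : ℕ → A) l m →
                       (∀ t → 1 ≤ t → t ≤ m → u (visit (l + t)) ≢ u (visit l)) →
                       ∀ {q} → visit l < q → ¬ S q → u q ≡ u (visit l) → visit (l + suc m) ≤ q
  visit-first-return u l m no-return {q} l<q ¬s uq≡ with visit (l + suc m) ℕ.≤? q
  ... | yes ≤q = ≤q
  ... | no  ≰q with visit-hits (suc m) l (ℕ.<⇒≤ l<q) (ℕ.<⇒≤ (ℕ.≰⇒> ≰q)) ¬s
  ...   | zero  , _ , eq = contradiction (trans (cong visit (sym (ℕ.+-identityʳ l))) eq) (ℕ.<⇒≢ l<q)
  ...   | suc t , s≤s t≤m , eq with ℕ.m≤n⇒m<n∨m≡n t≤m
  ...     | inj₁ t<m  = contradiction (trans (cong u eq) uq≡) (no-return (suc t) (s≤s z≤n) t<m)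
  ...     | inj₂ refl = contradiction eq (ℕ.<⇒≢ (ℕ.≰⇒> ≰q) ∘ sym)

module _ {n k : ℕ} (W : ClosedWalk n (suc k)) where

  covers-window : ∀ a v → ∃ λ o → o < suc k × seq W (a + o) ≡ v
  covers-window zero    v = covers W v
  covers-window (suc a) v with covers-window a v
  ... | zero  , _         , eq = k , ℕ.n<1+n k , trans (cong (seq W) (sym (ℕ.+-suc a k))) (trans (periodic W a)
                                                       (trans (cong (seq W) (sym (ℕ.+-identityʳ a))) eq))
  ... | suc o , s≤s o<k , eq = o , ℕ.m<n⇒m<1+n o<k , trans (cong (seq W) (sym (ℕ.+-suc a o))) eq

  periodic-multiple : ∀ a m → seq W (a + m * suc k) ≡ seq W a
  periodic-multiple a zero    = cong (seq W) (ℕ.+-identityʳ a)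
  periodic-multiple a (suc m) = begin
    seq W (a + (suc k + m * suc k))   ≡⟨ cong (seq W) (ℕ.+-assoc a (suc k) (m * suc k)) ⟨
    seq W (a + suc k + m * suc k)     ≡⟨ periodic-multiple (a + suc k) m ⟩
    seq W (a + suc k)                 ≡⟨ periodic W a ⟩
    seq W a                           ∎
    where open ≡-Reasoning

  rotate : ℕ → ClosedWalk n (suc k)
  rotate i = record
    { seq      = λ l → seq W (i + l)
    ; periodic = λ l → trans (cong (seq W) (sym (ℕ.+-assoc i l (suc k)))) (periodic W (i + l))
    ; noStay   = λ l → subst (λ p → seq W (i + l) ≢ seq W p) (sym (ℕ.+-suc i l)) (noStay W (i + l))
    ; covers   = covers-window i
    }

  rotate-revisit : ∀ (c : TravelTimes n) i r → RevisitBoundedBy c W r → RevisitBoundedBy c (rotate i) r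
  rotate-revisit c i r bounded l m back no-return =
    subst (_≤ℚ r) (sym (pathCost-shift (seq W) i l (suc m)))
          (bounded (i + l) m (trans (cong (seq W) (ℕ.+-assoc i l (suc m))) back)
                   (λ t 1≤t t≤m → subst (λ p → seq W p ≢ seq W (i + l)) (sym (ℕ.+-assoc i l t)) (no-return t 1≤t t≤m)))
    where open PathCost c

module Repeat (J′ e : ℕ) where

  J n P : ℕ
  J = suc J′
  n = J + e
  P = suc n

  J<P : J < P
  J<P = s≤s (ℕ.m≤m+n J e)

  module Blocks (x y : ℕ) .{{_ : NonZero (x + y)}} where

    Skipped : ℕ → Set
    Skipped p = p % P ≡ J × (p / P) % (x + y) < x

    skipped? : Decidable Skipped
    skipped? p = (p % P ℕ.≟ J) ×-dec ((p / P) % (x + y) ℕ.<? x)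

    open Skipping skipped? public

    block-% : ∀ b {o} → o < P → (b * P + o) % P ≡ o
    block-% b {o} o<P = begin
      (b * P + o) % P   ≡⟨ cong (_% P) (ℕ.+-comm (b * P) o) ⟩
      (o + b * P) % P   ≡⟨ [m+kn]%n≡m%n o b P ⟩
      o % P             ≡⟨ m<n⇒m%n≡m o<P ⟩
      o                 ∎
      where open ≡-Reasoning

    block-/ : ∀ b {o} → o < P → (b * P + o) / P ≡ b
    block-/ b {o} o<P = begin
      (b * P + o) / P     ≡⟨ cong (_/ P) (ℕ.+-comm (b * P) o) ⟩
      (o + b * P) / P     ≡⟨ +-distrib-/-∣ʳ o (n∣m*n b) ⟩
      o / P + b * P / P   ≡⟨ cong₂ _+_ (m<n⇒m/n≡0 o<P) (m*n/n≡m b P) ⟩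
      b                   ∎
      where open ≡-Reasoning

    skipped-at-J : ∀ {p} → Skipped p → p ≡ J + (p / P) * P
    skipped-at-J {p} (p%P≡J , _) = trans (m≡m%n+[m/n]*n p P) (cong (_+ (p / P) * P) p%P≡J)

    offset-∉ : ∀ b {o} → o ≤ P → o ≢ J → ¬ Skipped (b * P + o)
    offset-∉ b {o} o≤P o≢J (p%P≡J , _) with ℕ.m≤n⇒m<n∨m≡n o≤P
    ... | inj₁ o<P = o≢J (trans (sym (block-% b o<P)) p%P≡J)
    ... | inj₂ refl = J≢0 (trans (sym p%P≡J) (trans (cong (_% P) (ℕ.+-comm (b * P) P)) (m*n%n≡0 (suc b) P)))
      where
        J≢0 : J ≢ 0
        J≢0 ()

    block-index : ∀ {b} → b < x + y → (b * P + J) / P % (x + y) ≡ b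
    block-index {b} b<x+y = trans (cong (_% (x + y)) (block-/ b J<P)) (m<n⇒m%n≡m b<x+y)

    short-∈ : ∀ {b} → b < x → Skipped (b * P + J)
    short-∈ {b} b<x = block-% b J<P , subst (_< x) (sym (block-index (ℕ.<-≤-trans b<x (ℕ.m≤m+n x y)))) b<x

    long-∉ : ∀ {b} → x ≤ b → b < x + y → ¬ Skipped (b * P + J)
    long-∉ {b} x≤b b<x+y (_ , b%<x) = ℕ.<⇒≱ (subst (_< x) (block-index b<x+y) b%<x) x≤b

    Skipped-periodic : ∀ p → Skipped (p + (x + y) * P) ⇔ Skipped p
    Skipped-periodic p = mk⇔ (λ (r , b) → trans (sym rem≡) r , subst (_< x) blk≡ b)
                             (λ (r , b) → trans rem≡ r , subst (_< x) (sym blk≡) b)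
      where
        rem≡ : (p + (x + y) * P) % P ≡ p % P
        rem≡ = [m+kn]%n≡m%n p (x + y) P
        blk≡ : (p + (x + y) * P) / P % (x + y) ≡ p / P % (x + y)
        blk≡ = begin
          (p + (x + y) * P) / P % (x + y)         ≡⟨ cong (_% (x + y)) (+-distrib-/-∣ʳ p (n∣m*n (x + y))) ⟩
          (p / P + (x + y) * P / P) % (x + y)     ≡⟨ cong (λ q → (p / P + q) % (x + y)) (m*n/n≡m (x + y) P) ⟩
          (p / P + (x + y)) % (x + y)             ≡⟨ [m+n]%n≡m%n (p / P) (x + y) ⟩
          p / P % (x + y)                         ∎
          where open ≡-Reasoning

    short-block : ∀ {b L} → b < x → visit L ≡ b * P → visit (L + n) ≡ suc b * P
    short-block {b} {L} b<x visit-L = begin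
      visit (L + n)                       ≡⟨ cong visit (arrange L J′ e) ⟩
      visit (suc (L + J′) + e)            ≡⟨ visit-run e (suc (L + J′)) jump after-repeat ⟩
      suc (suc (b * P + J′)) + e          ≡⟨ close b J′ e ⟩
      suc b * P                           ∎
      where
        open ≡-Reasoning
        arrange : ∀ L J′ e → L + suc (J′ + e) ≡ suc (L + J′) + e
        arrange = solve-∀
        close : ∀ b J′ e → suc (suc (b * suc (suc (J′ + e)) + J′)) + e ≡ suc b * suc (suc (J′ + e))
        close = solve-∀
        offset : ∀ b J′ e o → suc (suc (suc (b * suc (suc (J′ + e)) + J′)) + o)
                               ≡ b * suc (suc (J′ + e)) + suc (suc (J′ + suc o))
        offset = solve-∀
        before-repeat : ∀ o → o < J′ → ¬ Skipped (suc (b * P + o))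
        before-repeat o o<J′ = offset-∉ b (ℕ.≤-trans (ℕ.m<n⇒m<1+n o<J′) (ℕ.<⇒≤ J<P)) (ℕ.<⇒≢ (s≤s o<J′))
                               ∘′ subst Skipped (sym (ℕ.+-suc (b * P) o))
        jump : visit (suc (L + J′)) ≡ suc (suc (b * P + J′))
        jump = trans (cong next (visit-run J′ L visit-L before-repeat))
                     (next-∈ (subst Skipped (ℕ.+-suc (b * P) J′) (short-∈ b<x)))
        after-repeat : ∀ o → o < e → ¬ Skipped (suc (suc (suc (b * P + J′)) + o))
        after-repeat o o<e = offset-∉ b (s≤s (s≤s (ℕ.+-monoʳ-≤ J′ o<e)))
                                       (λ eq → ℕ.<⇒≢ (s≤s (ℕ.m≤m+n J′ (suc o))) (sym (ℕ.suc-injective eq)))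
                             ∘′ subst Skipped (offset b J′ e o)

    long-block : ∀ {b L} → x ≤ b → b < x + y → visit L ≡ b * P → visit (L + P) ≡ suc b * P
    long-block {b} {L} x≤b b<x+y visit-L = trans (visit-run P L visit-L not-skipped) (ℕ.+-comm (b * P) P)
      where
        not-skipped : ∀ o → o < P → ¬ Skipped (suc (b * P + o))
        not-skipped o o<P with suc o ℕ.≟ J
        ... | yes refl = long-∉ x≤b b<x+y ∘′ subst Skipped (sym (ℕ.+-suc (b * P) o))
        ... | no  o≢J  = offset-∉ b o<P o≢J ∘′ subst Skipped (sym (ℕ.+-suc (b * P) o))

    visit-short-blocks : ∀ b → b ≤ x → visit (b * n) ≡ b * P
    visit-short-blocks zero    _   = refl
    visit-short-blocks (suc b) b<x =
      trans (cong visit (ℕ.+-comm n (b * n))) (short-block {L = b * n} b<x (visit-short-blocks b (ℕ.<⇒≤ b<x)))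

    visit-long-blocks : ∀ d → d ≤ y → visit (x * n + d * P) ≡ (x + d) * P
    visit-long-blocks zero    _   = begin
      visit (x * n + 0)   ≡⟨ cong visit (ℕ.+-identityʳ (x * n)) ⟩
      visit (x * n)       ≡⟨ visit-short-blocks x ℕ.≤-refl ⟩
      x * P               ≡⟨ cong (_* P) (ℕ.+-identityʳ x) ⟨
      (x + 0) * P         ∎
      where open ≡-Reasoning
    visit-long-blocks (suc d) d<y = begin
      visit (x * n + suc d * P)   ≡⟨ cong (λ q → visit (x * n + q)) (ℕ.+-comm P (d * P)) ⟩
      visit (x * n + (d * P + P)) ≡⟨ cong visit (ℕ.+-assoc (x * n) (d * P) P) ⟨
      visit (x * n + d * P + P)   ≡⟨ long-block {L = x * n + d * P} (ℕ.m≤m+n x d) (ℕ.+-monoʳ-< x d<y) (visit-long-blocks d (ℕ.<⇒≤ d<y)) ⟩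
      suc (x + d) * P             ≡⟨ cong (_* P) (ℕ.+-suc x d) ⟨
      (x + suc d) * P             ∎
      where open ≡-Reasoning

  module OneRepeat (W : ClosedWalk n P) (repeat : seq W J ≡ seq W 0) where

    repeated-target : ∀ {p q} → 0 < p → p < q → q ≤ P → seq W p ≡ seq W q → seq W p ≡ seq W 0
    repeated-target {suc a} {suc b} _ (s≤s a<b) (s≤s b≤n) eq = begin
      seq W (suc a)          ≡⟨ f-fromℕ< a<P ⟨
      f (fromℕ< a<P)         ≡⟨ surjection-collisions-agree f f-surjective
                                  (distinct J′<P n<P J′<n) repeat-in-f (distinct a<P b<P a<b) eq-in-f ⟩
      f (fromℕ< J′<P)        ≡⟨ f-fromℕ< J′<P ⟩
      seq W J                ≡⟨ repeat ⟩
      seq W 0                ∎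
      where
        open ≡-Reasoning
        f : Fin P → Fin n
        f t = seq W (suc (toℕ t))
        f-fromℕ< : ∀ {o} (o<P : o < P) → f (fromℕ< o<P) ≡ seq W (suc o)
        f-fromℕ< o<P = cong (seq W ∘ suc) (Fin.toℕ-fromℕ< o<P)
        f-surjective : ∀ v → ∃ λ t → f t ≡ v
        f-surjective v with o , o<P , eq ← covers-window W 1 v = fromℕ< o<P , trans (f-fromℕ< o<P) eq
        distinct : ∀ {a b} (a<P : a < P) (b<P : b < P) → a < b → fromℕ< a<P ≢ fromℕ< b<P
        distinct a<P b<P a<b eq = ℕ.<⇒≢ a<b (Fin.fromℕ<-injective _ _ a<P b<P eq)
        J′<n : J′ < n
        J′<n = ℕ.<-≤-trans (ℕ.n<1+n J′) (ℕ.m≤m+n J e)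
        J′<P = ℕ.m<n⇒m<1+n J′<n
        n<P = ℕ.n<1+n n
        a<P = ℕ.<-trans a<b (s≤s b≤n)
        b<P = s≤s b≤n
        repeat-in-f : f (fromℕ< J′<P) ≡ f (fromℕ< n<P)
        repeat-in-f = trans (f-fromℕ< J′<P) (trans repeat (sym (trans (f-fromℕ< n<P) (periodic W 0))))
        eq-in-f : f (fromℕ< a<P) ≡ f (fromℕ< b<P)
        eq-in-f = trans (f-fromℕ< a<P) (trans eq (sym (f-fromℕ< b<P)))

    first-target-once : ∀ l → 1 ≤ l → l ≤ n → seq W (1 + l) ≢ seq W 1
    first-target-once l 1≤l l≤n eq = noStay W 0 (sym (repeated-target (s≤s z≤n) (s≤s 1≤l) (s≤s l≤n) (sym eq)))

    repeat-neighbours-differ : seq W J′ ≢ seq W (suc J)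
    repeat-neighbours-differ eq = noStay W J′ (trans (repeated-target 0<J′ (ℕ.m<n⇒m<1+n (ℕ.n<1+n J′)) J<P eq) (sym repeat))
      where
        0<J′ : 0 < J′
        0<J′ = ℕ.n≢0⇒n>0 (λ J′≡0 → noStay W 0 (sym (subst (λ j → seq W (suc j) ≡ seq W 0) J′≡0 repeat)))

    period-cost-≤ : ∀ (c : TravelTimes n) r → RevisitBoundedBy c W r → ∀ a → pathCost c (seq W) a P ≤ℚ r
    period-cost-≤ c r bounded a = subst (_≤ℚ r) (trans (rotation 1) (sym (rotation a)))
                                        (bounded 1 n (periodic W 1) first-target-once)
      where
        open PathCost c
        rotation = pathCost-rotate (seq W) P (periodic W)

  module Construction (x y : ℕ) .{{_ : NonZero (x + y)}} (W : ClosedWalk n P) (repeat : seq W J ≡ seq W 0) where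
    open Blocks x y
    open OneRepeat W repeat

    k Q : ℕ
    k = x * n + y * P
    Q = (x + y) * P

    P≤Q : P ≤ Q
    P≤Q = ℕ.m≤n*m P (x + y)

    visit-k : visit k ≡ Q
    visit-k = visit-long-blocks y ℕ.≤-refl

    0<k : 0 < k
    0<k = ℕ.n≢0⇒n>0 (λ k≡0 → ℕ.<⇒≢ (ℕ.<-≤-trans (s≤s z≤n) P≤Q) (trans (sym (cong visit k≡0)) visit-k))

    skipped-value : ∀ {p} → Skipped p → seq W p ≡ seq W 0
    skipped-value {p} sk = begin
      seq W p                 ≡⟨ cong (seq W) (skipped-at-J sk) ⟩
      seq W (J + p / P * P)   ≡⟨ periodic-multiple W J (p / P) ⟩
      seq W J                 ≡⟨ repeat ⟩
      seq W 0                 ∎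
      where open ≡-Reasoning

    -- If visit a + P is deleted, it is visit J of its block, and the block start carries the same target.
    returns-within-period : ∀ a → ∃ λ q → a < q × q ≤ a + P × ¬ Skipped q × seq W q ≡ seq W a
    returns-within-period a with skipped? (a + P)
    ... | no  ¬sk = a + P , ℕ.m<m+n a (s≤s z≤n) , ℕ.≤-refl , ¬sk , periodic W a
    ... | yes sk  = b * P , a<bP , subst (b * P ≤_) (sym a+P≡) (ℕ.m≤n+m (b * P) J) , ¬sk , same
      where
        b = (a + P) / P
        a+P≡ : a + P ≡ J + b * P
        a+P≡ = skipped-at-J sk
        a<bP : a < b * P
        a<bP = ℕ.+-cancelʳ-< P a (b * P)
                 (subst (_< b * P + P) (sym a+P≡) (subst (J + b * P <_) (ℕ.+-comm P (b * P)) (ℕ.+-monoˡ-< (b * P) J<P)))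
        ¬sk : ¬ Skipped (b * P)
        ¬sk = offset-∉ b z≤n (λ ()) ∘′ subst Skipped (sym (ℕ.+-identityʳ (b * P)))
        same : seq W (b * P) ≡ seq W a
        same = trans (periodic-multiple W 0 b) (trans (sym (skipped-value sk)) (periodic W a))

    walk-noStay : ∀ l → seq W (visit l) ≢ seq W (visit (suc l))
    walk-noStay l with next-cases (visit l)
    ... | inj₁ (next≡ , _)  = λ eq → noStay W (visit l) (trans eq (cong (seq W) next≡))
    ... | inj₂ (next≡ , sk) = λ eq → repeat-neighbours-differ (begin
      seq W J′                    ≡⟨ periodic-multiple W J′ b ⟨
      seq W (J′ + b * P)          ≡⟨ cong (seq W) (ℕ.suc-injective (skipped-at-J sk)) ⟨
      seq W (visit l)             ≡⟨ eq ⟩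
      seq W (next (visit l))      ≡⟨ cong (seq W) (trans next≡ (cong suc (skipped-at-J sk))) ⟩
      seq W (suc J + b * P)       ≡⟨ periodic-multiple W (suc J) b ⟩
      seq W (suc J)               ∎)
      where
        open ≡-Reasoning
        b = suc (visit l) / P

    walk-covers : ∀ v → ∃ λ l → l < k × seq W (visit l) ≡ v
    walk-covers v with p , p<P , p↦v ← covers W v | skipped? p
    ... | yes sk  = 0 , 0<k , trans (sym (skipped-value sk)) p↦v
    ... | no  ¬sk with t , t≤k , t↦p ← visit-hits k 0 z≤n (subst (p ≤_) (sym visit-k) (ℕ.≤-trans (ℕ.<⇒≤ p<P) P≤Q)) ¬sk
      = t , ℕ.≤∧≢⇒< t≤k t≢k , trans (cong (seq W) t↦p) p↦v
      where
        t≢k : t ≢ k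
        t≢k t≡k = ℕ.<⇒≢ (ℕ.<-≤-trans p<P P≤Q) (trans (sym t↦p) (trans (cong visit t≡k) visit-k))

    walk : ClosedWalk n k
    walk = record
      { seq      = seq W ∘ visit
      ; periodic = λ l → trans (cong (seq W) (visit-periodic Skipped-periodic visit-k l)) (periodic-multiple W (visit l) (x + y))
      ; noStay   = walk-noStay
      ; covers   = walk-covers
      }

    walk-revisit : ∀ (c : TravelTimes n) → ValidTravelTimes n c → ∀ r → RevisitBoundedBy c W r → RevisitBoundedBy c walk r
    walk-revisit c valid r bounded l m _ no-return = begin
      pathCost c (seq W ∘ visit) l (suc m)                          ≤⟨ pathCost-shortcut valid (seq W) visit (ℕ.<⇒≤ ∘ visit-<) (suc m) l ⟩
      pathCost c (seq W) (visit l) (visit (l + suc m) ∸ visit l)    ≤⟨ pathCost-mono valid (seq W) (visit l) gap≤P ⟩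
      pathCost c (seq W) (visit l) P                                ≤⟨ period-cost-≤ c r bounded (visit l) ⟩
      r                                                             ∎
      where
        open PathCost c
        open ℚ.≤-Reasoning
        gap≤P : visit (l + suc m) ∸ visit l ≤ P
        gap≤P with q , l<q , q≤ , ¬sk , same ← returns-within-period (visit l) =
          ℕ.m≤n+o⇒m∸n≤o _ _ (ℕ.≤-trans (visit-first-return (seq W) l m no-return l<q ¬sk same) q≤)

n-suc-n-combination : ∀ n k → n * n ∸ n ≤ k → ∃₂ λ x y → x * n + y * suc n ≡ k
n-suc-n-combination zero     k _ = 0 , k , ℕ.*-identityʳ k
n-suc-n-combination n@(suc m) k m*n≤k = q ∸ r , r , (begin
  (q ∸ r) * n + r * suc n     ≡⟨ regroup (q ∸ r) r n ⟩
  r + (q ∸ r + r) * n         ≡⟨ cong (λ z → r + z * n) (ℕ.m∸n+n≡m r≤q) ⟩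
  r + q * n                   ≡⟨ m≡m%n+[m/n]*n k n ⟨
  k                           ∎)
  where
    open ≡-Reasoning
    q = k / n
    r = k % n
    regroup : ∀ a r n → a * n + r * suc n ≡ r + (a + r) * n
    regroup = solve-∀
    m≤q : m ≤ q
    m≤q = subst (_≤ q) (m*n/n≡m m n) (/-monoˡ-≤ n (subst (_≤ k) (ℕ.m+n∸m≡n n (m * n)) m*n≤k))
    r≤q : r ≤ q
    r≤q = ℕ.≤-trans (ℕ.≤-pred (m%n<n k n)) m≤q

combination-nonZero : ∀ {n k} x y → x * n + y * suc n ≡ k → 0 < k → NonZero (x + y)
combination-nonZero (suc x) y    _    _  = _
combination-nonZero zero (suc y) _    _  = _
combination-nonZero zero zero    refl ()

repeat-in-first-period : ∀ {n} (W : ClosedWalk n (suc n)) →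
                         ∃ λ i → ∃₂ λ J′ e → suc J′ + e ≡ n × seq W (i + suc J′) ≡ seq W i
repeat-in-first-period {n} W =
  let a , b , a<b , same = Fin.pigeonhole (ℕ.n<1+n n) (seq W ∘ toℕ)
      J′ , a+J≡b         = ℕ.m≤n⇒∃[o]m+o≡n a<b
      a+J≡b′             = trans (ℕ.+-suc (toℕ a) J′) a+J≡b
      J≤n                = ℕ.≤-trans (ℕ.m≤n+m (suc J′) (toℕ a))
                                     (subst (_≤ n) (sym a+J≡b′) (ℕ.≤-pred (Fin.toℕ<n b)))
      e , J+e≡n          = ℕ.m≤n⇒∃[o]m+o≡n J≤n
  in toℕ a , J′ , e , J+e≡n , trans (cong (seq W) a+J≡b′) (sym same)

lemma8 : (n : ℕ) → 2 ≤ n → (c : TravelTimes n) → ValidTravelTimes n c →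
         (k : ℕ) → n * n ∸ n < k → ¬ (n ∣ k) →
         (W : ClosedWalk n (suc n)) →
         ∃ λ (W′ : ClosedWalk n k) →
           ∀ (r : ℚ) → RevisitBoundedBy c W r → RevisitBoundedBy c W′ r
lemma8 n _ c valid k n²-n<k _ W
  with i , J′ , e , refl , repeat ← repeat-in-first-period W
     | x , y , x*n+y*P≡k ← n-suc-n-combination n k (ℕ.<⇒≤ n²-n<k)
  = subst (λ k → ∃ λ (W′ : ClosedWalk n k) → ∀ r → RevisitBoundedBy c W r → RevisitBoundedBy c W′ r) x*n+y*P≡k
      (walk , λ r → walk-revisit c valid r ∘ rotate-revisit W c i r)
  where
    instance
      _ : NonZero (x + y)
      _ = combination-nonZero x y x*n+y*P≡k (ℕ.<-≤-trans (s≤s z≤n) n²-n<k)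
    open Repeat.Construction J′ e x y (rotate W i) (trans repeat (cong (seq W) (sym (ℕ.+-identityʳ i))))
      using (walk; walk-revisit)
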